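{- Let $c$ be a Coxeter element of $\widehat{\mathfrak S}_n$ and $\prec$ a $c$-sortable TITO on $\mathbb Z$ which is not a single waxing block; let $M$ be its waning block. Then for every $a\in M$ there exist $t\in\mathrm{Cov}(\prec)$ and $b\in M$ such that $t=(a,b)$.
   Context: A Coxeter element $c$ of $\widehat{\mathfrak S}_n$ (product, once each, of the simple generators $s_i$, $0\le i\le n-1$, exchanging $i+mn$ and $i+1+mn$ for all $m$) moves every integer; $\overline{L_c}=\{x:c(x)>x\}$, $\overline{R_c}=\{x:c(x)<x\}$. A (real) TITO on $\mathbb Z$ is a total order $\prec$ with $x\prec y\iff x+n\prec y+n$ and no cover relation $x+n\prec x$. Blocks are the classes of the equivalence "finitely many elements $\prec$-between"; they are $\prec$-intervals, unions of residue classes mod $n$, linearly ordered; a block is waning if $x+n\prec x$ for its elements, waxing otherwise. $\prec$ is $c$-sortable if (1) either it is a single waxing block, or its blocks are, in order, possibly a waxing block contained in $\overline{L_c}$, a waning block meeting both $\overline{L_c}$ and $\overline{R_c}$, possibly a waxing block contained in $\overline{R_c}$, and no others; and (2) there are no $i<j<k$ with $k\prec i\prec j$, $j\in\overline{L_c}$, nor with $j\prec k\prec i$, $j\in\overline{R_c}$. For $a\not\equiv b\pmod n$, $(a,b)$ is the affine transposition exchanging $a+mn,b+mn$ for all $m$. $\mathrm{Cov}(\prec)$ is the set of $(p,q)$ with $p<q$, $p\not\equiv q$, such that $q$ immediately precedes $p$ in $\prec$. -}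

module Defs where

open import Data.Nat as ℕ using (ℕ)
open import Data.Nat.Divisibility using (_∣?_)
open import Data.Integer using (ℤ; +_; _+_; _-_; _<_; ∣_∣)
open import Data.Integer.Properties using ()
open import Data.Fin using (Fin; toℕ)
open import Data.List using (List; allFin; foldr)
open import Data.List.Membership.Propositional using (_∈_)
open import Data.List.Relation.Binary.Permutation.Propositional using (_↭_)
open import Data.Bool using (if_then_else_)
open import Data.Product using (Σ; _×_; ∃; ∃-syntax)
open import Data.Sum using (_⊎_)
open import Relation.Nullary using (¬_)
open import Relation.Nullary.Decidable using (⌊_⌋)
open import Relation.Binary.PropositionalEquality using (_≡_)
open import Function using (_∘_; id)

_≡[_]_ : ℤ → ℕ → ℤ → Set
a ≡[ n ] b = n Data.Nat.Divisibility.∣ ∣ a - b ∣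
  where import Data.Nat.Divisibility

cong? : ℕ → ℤ → ℤ → Data.Bool.Bool
cong? n a b = ⌊ n ∣? ∣ a - b ∣ ⌋

sgen : (n : ℕ) → Fin n → ℤ → ℤ
sgen n i x =
  if cong? n x (+ toℕ i) then x + + 1
  else if cong? n x (+ toℕ i + + 1) then x - + 1
  else x

prodGen : (n : ℕ) → List (Fin n) → ℤ → ℤ
prodGen n w = foldr (λ i f → sgen n i ∘ f) id w

IsCoxeter : (n : ℕ) → (ℤ → ℤ) → Set
IsCoxeter n c = Σ (List (Fin n)) λ w → (w ↭ allFin n) × (∀ x → c x ≡ prodGen n w x)

-- affine transposition (a,b): exchanges a + m n and b + m n for all m
-- (only meaningful when a ≢ b mod n)
transp : ℕ → ℤ → ℤ → ℤ → ℤ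
transp n a b x =
  if cong? n x a then x + (b - a)
  else if cong? n x b then x + (a - b)
  else x

record StrictTotal (_≺_ : ℤ → ℤ → Set) : Set where
  field
    irrefl : ∀ x → ¬ (x ≺ x)
    trans  : ∀ x y z → x ≺ y → y ≺ z → x ≺ z
    total  : ∀ x y → x ≺ y ⊎ (x ≡ y ⊎ y ≺ x)

Covers : (ℤ → ℤ → Set) → ℤ → ℤ → Set
Covers _≺_ x y = x ≺ y × (∀ z → ¬ (x ≺ z × z ≺ y))

record TITO (n : ℕ) (_≺_ : ℤ → ℤ → Set) : Set where
  field
    strictTotal : StrictTotal _≺_
    transl      : ∀ x y → (x ≺ y → (x + + n) ≺ (y + + n)) × ((x + + n) ≺ (y + + n) → x ≺ y)
    noCover     : ∀ x → ¬ Covers _≺_ (x + + n) x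

Between : (ℤ → ℤ → Set) → ℤ → ℤ → ℤ → Set
Between _≺_ x y z = (x ≺ z × z ≺ y) ⊎ (y ≺ z × z ≺ x)

-- same block: only finitely many elements between x and y
-- (finite = all contained in some finite list)
SameBlock : (ℤ → ℤ → Set) → ℤ → ℤ → Set
SameBlock _≺_ x y = Σ (List ℤ) λ L → ∀ z → Between _≺_ x y z → z ∈ L

WaningBlock : ℕ → (ℤ → ℤ → Set) → ℤ → Set
WaningBlock n _≺_ m = ∀ x → SameBlock _≺_ x m → (x + + n) ≺ x

WaxingBlock : ℕ → (ℤ → ℤ → Set) → ℤ → Set
WaxingBlock n _≺_ m = ∀ x → SameBlock _≺_ x m → ¬ ((x + + n) ≺ x)

InL : (ℤ → ℤ) → ℤ → Set
InL c x = x < c x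

InR : (ℤ → ℤ) → ℤ → Set
InR c x = c x < x

SingleWaxing : ℕ → (ℤ → ℤ → Set) → Set
SingleWaxing n _≺_ = (∀ x y → SameBlock _≺_ x y) × (∀ x → ¬ ((x + + n) ≺ x))

-- blocks are, in order: possibly a waxing block ⊆ L̄_c, a waning block
-- (that of m) meeting L̄_c and R̄_c, possibly a waxing block ⊆ R̄_c, no others
ThreeBlocks : ℕ → (ℤ → ℤ) → (ℤ → ℤ → Set) → Set
ThreeBlocks n c _≺_ = Σ ℤ λ m →
    WaningBlock n _≺_ m
  × (∃[ x ] (SameBlock _≺_ x m × InL c x))
  × (∃[ x ] (SameBlock _≺_ x m × InR c x))
  × (∀ x → ¬ SameBlock _≺_ x m → x ≺ m →
        InL c x × WaxingBlock n _≺_ x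
        × (∀ y → ¬ SameBlock _≺_ y m → y ≺ m → SameBlock _≺_ x y))
  × (∀ x → ¬ SameBlock _≺_ x m → m ≺ x →
        InR c x × WaxingBlock n _≺_ x
        × (∀ y → ¬ SameBlock _≺_ y m → m ≺ y → SameBlock _≺_ x y))

record Sortable (n : ℕ) (c : ℤ → ℤ) (_≺_ : ℤ → ℤ → Set) : Set where
  field
    blocks : SingleWaxing n _≺_ ⊎ ThreeBlocks n c _≺_
    noL    : ∀ i j k → i < j → j < k → ¬ (k ≺ i × i ≺ j × InL c j)
    noR    : ∀ i j k → i < j → j < k → ¬ (j ≺ k × k ≺ i × InR c j)

InCov : ℕ → (ℤ → ℤ → Set) → ℤ → ℤ → Set
InCov n _≺_ p q = p < q × ¬ (p ≡[ n ] q) × Covers _≺_ q p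

-- If a ∈ L̄, every z with a + n ≺ z ≺ a is waning, and condition (2)
-- of sortability confines it to the integers a < z ≤ max(a + n, r), where r ∈ R̄ is a waning element
-- preceding a + n; such r exist because the waning block meets R̄ and L̄.  So this ≺-interval is finite
-- and a has an immediate predecessor q with a + n ≼ q, whence a < q.  The only element of a + nℤ in
-- [a + n, a) is a + n, which cannot cover a in a TITO, so q ≢ a (mod n) and (a, q) ∈ Cov.  If a ∈ R̄
-- the mirror argument gives an immediate successor s of a with (s, a) ∈ Cov.  A Coxeter element moves
-- every integer, so the two cases are exhaustive, and a covering pair lies in a single block.

module Submission where

open import Defs
open import Data.Nat as ℕ using (ℕ; zero; suc; NonZero; z≤n; s≤s; _≤_)
import Data.Nat.Properties as ℕ
import Data.Nat.Divisibility as ℕ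
open import Data.Integer as ℤ
  using (ℤ; +_; -[1+_]; _+_; _-_; _*_; -_; ∣_∣; _<_; _⊔_; _⊓_; +≤+; -≤+)
open import Data.Integer.Properties
open import Data.Integer.Divisibility.Signed using (_∣_; divides; ∣ᵤ⇒∣; ∣⇒∣ᵤ; ∣m∣n⇒∣m+n)
open import Data.Integer.DivMod using (_%ℕ_; _/ℕ_; n%ℕd<d; a≡a%ℕn+[a/ℕn]*n)
open import Data.Integer.Tactic.RingSolver using (solve-∀)
open import Data.Fin using (Fin; toℕ; fromℕ<)
open import Data.Fin.Properties using (toℕ-injective; toℕ<n; toℕ-fromℕ<)
open import Data.List using (List; []; _∷_; _++_; allFin; filter; applyUpTo)
open import Data.List.Membership.Propositional using (_∈_)
open import Data.List.Membership.Propositional.Properties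
  using (∈-allFin; ∈-filter⁺; ∈-++⁺ˡ; ∈-++⁺ʳ; ∈-applyUpTo⁺)
open import Data.List.Relation.Unary.All.Properties using (all-filter)
open import Data.List.Relation.Unary.Any using (here; there)
open import Data.List.Relation.Unary.All as All using (All)
open import Data.List.Relation.Unary.AllPairs using ([]; _∷_)
open import Data.List.Relation.Unary.Unique.Propositional using (Unique)
open import Data.List.Relation.Unary.Unique.Propositional.Properties using (allFin⁺)
open import Data.List.Relation.Binary.Permutation.Propositional using (↭-sym; ↭⇒↭ₛ)
open import Data.List.Relation.Binary.Permutation.Propositional.Properties using (∈-resp-↭)
import Data.List.Relation.Binary.Permutation.Setoid.Properties as Setoid↭
open import Data.Product using (_×_; _,_; ∃-syntax; proj₁; proj₂; map₂)
open import Data.Sum using (_⊎_; inj₁; inj₂; swap; [_,_]′)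
open import Data.Bool using (true; false)
open import Data.Empty using (⊥-elim)
open import Function using (_∘_; id)
open import Relation.Binary.Bundles using (StrictTotalOrder; DecTotalOrder)
open import Relation.Binary.Structures using (IsStrictTotalOrder)
open import Relation.Binary.Definitions using (Trichotomous; tri<; tri≈; tri>)
import Relation.Binary.Properties.StrictTotalOrder as StrictTotalOrderProperties
import Data.List.Extrema as Extrema
open import Relation.Nullary using (¬_; yes; no)
open import Relation.Binary.PropositionalEquality

i<i+1 : ∀ i → i < i + + 1
i<i+1 i = subst (_< i + + 1) (+-identityʳ i) (+-monoʳ-< i (ℤ.+<+ (s≤s z≤n)))

i-1<i : ∀ i → i - + 1 < i
i-1<i i = subst (i - + 1 <_) (+-identityʳ i) (+-monoʳ-< i ℤ.-<+)

i≤+∣i∣ : ∀ i → i ℤ.≤ + ∣ i ∣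
i≤+∣i∣ (+ _)    = ≤-refl
i≤+∣i∣ -[1+ _ ] = -≤+

shift-suc : ∀ x j N → x + + suc j * N ≡ (x + + j * N) + N
shift-suc x j N = regroup x (+ j) N
  where
  regroup : ∀ x k N → x + (+ 1 + k) * N ≡ (x + k * N) + N
  regroup = solve-∀

shift-cancel : ∀ x k N → (x + (- k) * N) + k * N ≡ x
shift-cancel = solve-∀

commutes-with-ℕ-multiples : ∀ {N} (f : ℤ → ℤ) → (∀ x → f (x + N) ≡ f x + N) →
                            ∀ j x → f (x + + j * N) ≡ f x + + j * N
commutes-with-ℕ-multiples f f-periodic zero x = trans (cong f (+-identityʳ x)) (sym (+-identityʳ (f x)))
commutes-with-ℕ-multiples {N} f f-periodic (suc j) x = begin
  f (x + + suc j * N)    ≡⟨ cong f (shift-suc x j N) ⟩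
  f (x + + j * N + N)    ≡⟨ f-periodic (x + + j * N) ⟩
  f (x + + j * N) + N    ≡⟨ cong (_+ N) (commutes-with-ℕ-multiples f f-periodic j x) ⟩
  f x + + j * N + N      ≡⟨ shift-suc (f x) j N ⟨
  f x + + suc j * N      ∎
  where open ≡-Reasoning

commutes-with-multiples : ∀ {N} (f : ℤ → ℤ) → (∀ x → f (x + N) ≡ f x + N) →
                          ∀ k x → f (x + k * N) ≡ f x + k * N
commutes-with-multiples f f-periodic (+ j) = commutes-with-ℕ-multiples f f-periodic j
commutes-with-multiples {N} f f-periodic -[1+ j ] x = begin
  f x′                          ≡⟨ shift-cancel (f x′) (- k) N ⟨
  f x′ + - - k * N + - k * N    ≡⟨ cong (λ m → f x′ + m * N + - k * N) (neg-involutive k) ⟩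
  f x′ + k * N + - k * N        ≡⟨ cong (_+ - k * N) (commutes-with-ℕ-multiples f f-periodic (suc j) x′) ⟨
  f (x′ + k * N) + - k * N      ≡⟨ cong (λ y → f y + - k * N) (shift-cancel x k N) ⟩
  f x + - k * N                 ∎
  where
  open ≡-Reasoning
  k = + suc j
  x′ = x + - k * N

integers-between : ℤ → ℤ → List ℤ
integers-between lo hi = applyUpTo (λ k → lo + + k) (suc ∣ hi - lo ∣)

∈-integers-between : ∀ {lo hi z} → lo ℤ.≤ z → z ℤ.≤ hi → z ∈ integers-between lo hi
∈-integers-between {lo} {hi} {z} lo≤z z≤hi =
  subst (_∈ integers-between lo hi) lo+offset≡z (∈-applyUpTo⁺ (λ k → lo + + k) (s≤s offset≤width))
  where
  +offset≡z-lo : + ∣ z - lo ∣ ≡ z - lo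
  +offset≡z-lo = 0≤i⇒+∣i∣≡i (i≤j⇒0≤j-i lo≤z)
  +width≡hi-lo : + ∣ hi - lo ∣ ≡ hi - lo
  +width≡hi-lo = 0≤i⇒+∣i∣≡i (i≤j⇒0≤j-i (≤-trans lo≤z z≤hi))
  lo+offset≡z : lo + + ∣ z - lo ∣ ≡ z
  lo+offset≡z = trans (cong (λ d → lo + d) +offset≡z-lo) (cancel lo z)
    where
    cancel : ∀ lo z → lo + (z - lo) ≡ z
    cancel = solve-∀
  offset≤width : ∣ z - lo ∣ ≤ ∣ hi - lo ∣
  offset≤width = drop‿+≤+ (subst₂ ℤ._≤_ (sym +offset≡z-lo) (sym +width≡hi-lo) (+-monoˡ-≤ (- lo) z≤hi))

module Congruence (n : ℕ) where

  N : ℤ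
  N = + n

  ≡[]⇒∣ : ∀ a b → a ≡[ n ] b → N ∣ a - b
  ≡[]⇒∣ a b = ∣ᵤ⇒∣ {i = a - b}

  ∣⇒≡[] : ∀ a b → N ∣ a - b → a ≡[ n ] b
  ∣⇒≡[] a b = ∣⇒∣ᵤ {i = a - b}

  ≡[]-sym : ∀ a b → a ≡[ n ] b → b ≡[ n ] a
  ≡[]-sym a b = subst (n ℕ.∣_) (∣i-j∣≡∣j-i∣ a b)

  ≡[]-trans : ∀ a b c → a ≡[ n ] b → b ≡[ n ] c → a ≡[ n ] c
  ≡[]-trans a b c p q =
    ∣⇒≡[] a c (subst (N ∣_) (telescope a b c) (∣m∣n⇒∣m+n (≡[]⇒∣ a b p) (≡[]⇒∣ b c q)))
    where
    telescope : ∀ a b c → (a - b) + (b - c) ≡ a - c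
    telescope = solve-∀

  private
    difference-+ : ∀ a b d → (a + d) - (b + d) ≡ a - b
    difference-+ = solve-∀

  ≡[]-+ʳ : ∀ a b d → a ≡[ n ] b → (a + d) ≡[ n ] (b + d)
  ≡[]-+ʳ a b d = subst (λ e → n ℕ.∣ ∣ e ∣) (sym (difference-+ a b d))

  ≡[]-+ʳ⁻ : ∀ a b d → (a + d) ≡[ n ] (b + d) → a ≡[ n ] b
  ≡[]-+ʳ⁻ a b d = subst (λ e → n ℕ.∣ ∣ e ∣) (difference-+ a b d)

  +N≡[] : ∀ x → (x + N) ≡[ n ] x
  +N≡[] x = ∣⇒≡[] (x + N) x (divides (+ 1) (period x N))
    where
    period : ∀ x N → (x + N) - x ≡ + 1 * N
    period = solve-∀

  ≡[]⇒multiple : ∀ x y → x ≡[ n ] y → ∃[ k ] (y ≡ x + k * N)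
  ≡[]⇒multiple x y p with ≡[]⇒∣ x y p
  ... | divides k x-y≡kN = - k , (begin
    y                 ≡⟨ rearrange x y ⟩
    x - (x - y)       ≡⟨ cong (λ m → x - m) x-y≡kN ⟩
    x - k * N         ≡⟨ cong (λ m → x + m) (neg-distribˡ-* k N) ⟩
    x + - k * N       ∎)
    where
    open ≡-Reasoning
    rearrange : ∀ x y → y ≡ x - (x - y)
    rearrange = solve-∀

  residue-injective : ∀ {i j : Fin n} → (+ toℕ i) ≡[ n ] (+ toℕ j) → i ≡ j
  residue-injective {i} {j} p =
    toℕ-injective (+-injective (i-j≡0⇒i≡j _ _ (∣i∣≡0⇒i≡0 (divisible-below p distance<n))))
    where
    divisible-below : ∀ {d} → n ℕ.∣ d → d ℕ.< n → d ≡ 0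
    divisible-below {zero} _ _ = refl
    divisible-below {suc d} n∣d d<n = ⊥-elim (ℕ.>⇒∤ d<n n∣d)
    distance<n : ∣ + toℕ i - + toℕ j ∣ ℕ.< n
    distance<n = subst (ℕ._< n) (cong ∣_∣ (sym (m-n≡m⊖n (toℕ i) (toℕ j))))
      (ℕ.≤-<-trans (∣m⊝n∣≤m⊔n (toℕ i) (toℕ j)) (ℕ.⊔-lub (toℕ<n i) (toℕ<n j)))

  residue : {{NonZero n}} → ∀ x → ∃[ i ] (x ≡[ n ] (+ toℕ {n} i))
  residue x = fromℕ< r<n , ∣⇒≡[] x _ (divides (x /ℕ n) (begin
      x - + toℕ (fromℕ< r<n)        ≡⟨ cong (λ r → x - + r) (toℕ-fromℕ< r<n) ⟩
      x - + (x %ℕ n)                ≡⟨ cong (_- + (x %ℕ n)) (a≡a%ℕn+[a/ℕn]*n x n) ⟩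
      (+ (x %ℕ n) + (x /ℕ n) * N) - + (x %ℕ n) ≡⟨ cancel (+ (x %ℕ n)) ((x /ℕ n) * N) ⟩
      (x /ℕ n) * N                  ∎))
    where
    open ≡-Reasoning
    r<n = n%ℕd<d x n
    cancel : ∀ r m → (r + m) - r ≡ m
    cancel = solve-∀

module AffineSymmetricGroup (n : ℕ) where

  open Congruence n

  ⌜_⌝ : Fin n → ℤ
  ⌜ i ⌝ = + toℕ i

  transp-sym : ∀ {p q} → ¬ (p ≡[ n ] q) → ∀ x → transp n p q x ≡ transp n q p x
  transp-sym {p} {q} p≢q x with n ℕ.∣? ∣ x - p ∣ | n ℕ.∣? ∣ x - q ∣
  ... | yes x≡p | yes x≡q = ⊥-elim (p≢q (≡[]-trans p x q (≡[]-sym x p x≡p) x≡q))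
  ... | yes _   | no _    = refl
  ... | no _    | yes _   = refl
  ... | no _    | no _    = refl

  cong?-periodic : ∀ x b → cong? n (x + N) b ≡ cong? n x b
  cong?-periodic x b with n ℕ.∣? ∣ (x + N) - b ∣ | n ℕ.∣? ∣ x - b ∣
  ... | yes _        | yes _       = refl
  ... | no _         | no _        = refl
  ... | yes x+N≡b    | no x≢b      =
    ⊥-elim (x≢b (≡[]-trans x (x + N) b (≡[]-sym (x + N) x (+N≡[] x)) x+N≡b))
  ... | no x+N≢b     | yes x≡b     =
    ⊥-elim (x+N≢b (≡[]-trans (x + N) x b (+N≡[] x) x≡b))

  sgen-periodic : ∀ i x → sgen n i (x + N) ≡ sgen n i x + N
  sgen-periodic i x rewrite cong?-periodic x ⌜ i ⌝ | cong?-periodic x (⌜ i ⌝ + + 1)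
    with cong? n x ⌜ i ⌝ | cong? n x (⌜ i ⌝ + + 1)
  ... | true  | _     = commute x N (+ 1)
    where
    commute : ∀ x a b → x + a + b ≡ x + b + a
    commute = solve-∀
  ... | false | true  = commute x N (+ 1)
    where
    commute : ∀ x a b → x + a - b ≡ x - b + a
    commute = solve-∀
  ... | false | false = refl

  prodGen-periodic : ∀ w x → prodGen n w (x + N) ≡ prodGen n w x + N
  prodGen-periodic []      x = refl
  prodGen-periodic (i ∷ w) x =
    trans (cong (sgen n i) (prodGen-periodic w x)) (sgen-periodic i (prodGen n w x))

  coxeter-periodic : ∀ {c} → IsCoxeter n c → ∀ x → c (x + N) ≡ c x + N
  coxeter-periodic {c} (w , _ , c≗w) x = begin
    c (x + N)           ≡⟨ c≗w (x + N) ⟩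
    prodGen n w (x + N) ≡⟨ prodGen-periodic w x ⟩
    prodGen n w x + N   ≡⟨ cong (_+ N) (c≗w x) ⟨
    c x + N             ∎
    where open ≡-Reasoning

  -- Once some generator s_i has moved x, x sits at residue i + 1 (raised) or i (lowered); a later
  -- generator s_j, j ≠ i, can only move it further in the same direction, since s_j raises residue j
  -- and lowers residue j + 1.
  data Displaced (w : List (Fin n)) (x : ℤ) : ℤ → Set where
    fixed   : (∀ {i} → i ∈ w → ¬ (x ≡[ n ] ⌜ i ⌝)) → Displaced w x x
    raised  : ∀ {y i} → x < y → i ∈ w → y ≡[ n ] (⌜ i ⌝ + + 1) → Displaced w x y
    lowered : ∀ {y i} → y < x → i ∈ w → y ≡[ n ] ⌜ i ⌝ → Displaced w x y

  displaced-∷ : ∀ {j w x y} → All (j ≢_) w → Displaced w x y → Displaced (j ∷ w) x (sgen n j y)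
  displaced-∷ {j} {w} {x} {y} j∉w d with n ℕ.∣? ∣ y - ⌜ j ⌝ ∣
  ... | yes y≡j = raised (below d) (here refl) (≡[]-+ʳ y ⌜ j ⌝ (+ 1) y≡j)
    where
    below : Displaced w x y → x < y + + 1
    below (fixed _)             = i<i+1 x
    below (raised x<y _ _)      = <-trans x<y (i<i+1 y)
    below (lowered {i = i} _ i∈w y≡i) =
      ⊥-elim (All.lookup j∉w i∈w
        (residue-injective (≡[]-trans ⌜ j ⌝ y ⌜ i ⌝ (≡[]-sym y ⌜ j ⌝ y≡j) y≡i)))
  ... | no y≢j with n ℕ.∣? ∣ y - (⌜ j ⌝ + + 1) ∣
  ...   | yes y≡j+1 = lowered (above d) (here refl) (≡[]-+ʳ⁻ (y - + 1) ⌜ j ⌝ (+ 1) y-1+1≡j+1)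
    where
    y-1+1 : ∀ y → y - + 1 + + 1 ≡ y
    y-1+1 = solve-∀
    y-1+1≡j+1 : (y - + 1 + + 1) ≡[ n ] (⌜ j ⌝ + + 1)
    y-1+1≡j+1 = subst (λ v → v ≡[ n ] (⌜ j ⌝ + + 1)) (sym (y-1+1 y)) y≡j+1
    above : Displaced w x y → y - + 1 < x
    above (fixed _)             = i-1<i x
    above (lowered y<x _ _)     = <-trans (i-1<i y) y<x
    above (raised {i = i} _ i∈w y≡i+1) = ⊥-elim (All.lookup j∉w i∈w (residue-injective
      (≡[]-+ʳ⁻ ⌜ j ⌝ ⌜ i ⌝ (+ 1) (≡[]-trans (⌜ j ⌝ + + 1) y _ (≡[]-sym y _ y≡j+1) y≡i+1))))
  ...   | no y≢j+1 = unmoved d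
    where
    unmoved : Displaced w x y → Displaced (j ∷ w) x y
    unmoved (fixed x≢w)           = fixed λ { (here refl) → y≢j ; (there i∈w) → x≢w i∈w }
    unmoved (raised x<y i∈w y≡i)  = raised x<y (there i∈w) y≡i
    unmoved (lowered y<x i∈w y≡i) = lowered y<x (there i∈w) y≡i

  displaced : ∀ {w} → Unique w → ∀ x → Displaced w x (prodGen n w x)
  displaced {[]}    []             x = fixed λ ()
  displaced {j ∷ w} (j∉w ∷ unique) x = displaced-∷ j∉w (displaced unique x)

  displaced-by-all : {{NonZero n}} → ∀ {w x y} → (∀ i → i ∈ w) → Displaced w x y → x < y ⊎ y < x
  displaced-by-all {x = x} all∈w (fixed x≢w)     = ⊥-elim (x≢w (all∈w _) (proj₂ (residue x)))
  displaced-by-all         _     (raised x<y _ _)  = inj₁ x<y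
  displaced-by-all         _     (lowered y<x _ _) = inj₂ y<x

  coxeter-moves : {{NonZero n}} → ∀ {c} → IsCoxeter n c → ∀ x → x < c x ⊎ c x < x
  coxeter-moves {c} (w , w↭all , c≗w) x =
    subst (λ y → x < y ⊎ y < x) (sym (c≗w x)) (displaced-by-all all∈w (displaced unique x))
    where
    unique : Unique w
    unique = Setoid↭.Unique-resp-↭ (setoid (Fin n)) (↭⇒↭ₛ (↭-sym w↭all)) (allFin⁺ n)
    all∈w : ∀ i → i ∈ w
    all∈w i = ∈-resp-↭ (↭-sym w↭all) (∈-allFin i)

module StrictTotalProperties {_≺_ : ℤ → ℤ → Set} (≺-strictTotal : StrictTotal _≺_) where

  open StrictTotal ≺-strictTotal using (irrefl; total) renaming (trans to ≺-trans′)

  infix 4 _≼_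
  _≼_ : ℤ → ℤ → Set
  x ≼ y = x ≺ y ⊎ x ≡ y

  ≺-trans : ∀ {x y z} → x ≺ y → y ≺ z → x ≺ z
  ≺-trans {x} {y} {z} = ≺-trans′ x y z

  ≺-irrefl : ∀ {x} → ¬ (x ≺ x)
  ≺-irrefl {x} = irrefl x

  ≺-asym : ∀ {x y} → x ≺ y → ¬ (y ≺ x)
  ≺-asym x≺y y≺x = ≺-irrefl (≺-trans x≺y y≺x)

  ≼-≺-trans : ∀ {x y z} → x ≼ y → y ≺ z → x ≺ z
  ≼-≺-trans (inj₁ x≺y) y≺z = ≺-trans x≺y y≺z
  ≼-≺-trans (inj₂ refl) y≺z = y≺z

  ≺-≼-trans : ∀ {x y z} → x ≺ y → y ≼ z → x ≺ z
  ≺-≼-trans x≺y (inj₁ y≺z) = ≺-trans x≺y y≺z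
  ≺-≼-trans x≺y (inj₂ refl) = x≺y

  ≼⇒⊁ : ∀ {x y} → x ≼ y → ¬ (y ≺ x)
  ≼⇒⊁ x≼y y≺x = ≺-irrefl (≼-≺-trans x≼y y≺x)

  ≢∧⊁⇒≺ : ∀ {x y} → x ≢ y → ¬ (y ≺ x) → x ≺ y
  ≢∧⊁⇒≺ {x} {y} x≢y y⊀x with total x y
  ... | inj₁ x≺y        = x≺y
  ... | inj₂ (inj₁ x≡y) = ⊥-elim (x≢y x≡y)
  ... | inj₂ (inj₂ y≺x) = ⊥-elim (y⊀x y≺x)

  ≺-compare : Trichotomous _≡_ _≺_
  ≺-compare x y with total x y
  ... | inj₁ x≺y        = tri< x≺y (λ { refl → ≺-irrefl x≺y }) (≺-asym x≺y)
  ... | inj₂ (inj₁ refl) = tri≈ ≺-irrefl refl ≺-irrefl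
  ... | inj₂ (inj₂ y≺x) = tri> (≺-asym y≺x) (λ { refl → ≺-irrefl y≺x }) y≺x

  ≺-isStrictTotalOrder : IsStrictTotalOrder _≡_ _≺_
  ≺-isStrictTotalOrder = record
    { isStrictPartialOrder = record
      { isEquivalence = isEquivalence
      ; irrefl        = λ { refl → ≺-irrefl }
      ; trans         = ≺-trans
      ; <-resp-≈      = (λ { refl x≺y → x≺y }) , (λ { refl y≺z → y≺z })
      }
    ; compare = ≺-compare
    }

  ≺-strictTotalOrder : StrictTotalOrder _ _ _
  ≺-strictTotalOrder = record { isStrictTotalOrder = ≺-isStrictTotalOrder }

  open StrictTotalOrder ≺-strictTotalOrder using () renaming (_<?_ to _≺?_)
  open Extrema (DecTotalOrder.totalOrder (StrictTotalOrderProperties.decTotalOrder ≺-strictTotalOrder))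
    using (max; min; ⊥≤max; xs≤max; min≤⊤; min≤xs; argmax-all; argmin-all)

  immediate-predecessor : ∀ {x y} zs → x ≺ y → (∀ z → x ≺ z → z ≺ y → z ∈ zs) →
                          ∃[ q ] (x ≼ q × Covers _≺_ q y)
  immediate-predecessor {x} {y} zs x≺y between∈zs = q , x≼q , q≺y , nothing-between
    where
    below-y = filter (_≺? y) zs
    q = max x below-y
    x≼q : x ≼ q
    x≼q = ⊥≤max x below-y
    q≺y : q ≺ y
    q≺y = argmax-all id x≺y (all-filter (_≺? y) zs)
    nothing-between : ∀ z → ¬ (q ≺ z × z ≺ y)
    nothing-between z (q≺z , z≺y) = ≼⇒⊁ (All.lookup (xs≤max x below-y) z∈below-y) q≺z
      where
      z∈below-y = ∈-filter⁺ (_≺? y) (between∈zs z (≼-≺-trans x≼q q≺z) z≺y) z≺y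

  immediate-successor : ∀ {x y} zs → x ≺ y → (∀ z → x ≺ z → z ≺ y → z ∈ zs) →
                        ∃[ s ] (s ≼ y × Covers _≺_ x s)
  immediate-successor {x} {y} zs x≺y between∈zs = s , s≼y , x≺s , nothing-between
    where
    above-x = filter (x ≺?_) zs
    s = min y above-x
    s≼y : s ≼ y
    s≼y = min≤⊤ y above-x
    x≺s : x ≺ s
    x≺s = argmin-all id x≺y (all-filter (x ≺?_) zs)
    nothing-between : ∀ z → ¬ (x ≺ z × z ≺ s)
    nothing-between z (x≺z , z≺s) = ≼⇒⊁ (All.lookup (min≤xs y above-x) z∈above-x) z≺s
      where
      z∈above-x = ∈-filter⁺ (x ≺?_) (between∈zs z x≺z (≺-≼-trans z≺s s≼y)) x≺z

  SameBlock-sym : ∀ {x y} → SameBlock _≺_ x y → SameBlock _≺_ y x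
  SameBlock-sym (zs , between∈zs) = zs , λ z → between∈zs z ∘ swap

  SameBlock-trans : ∀ {x y z} → SameBlock _≺_ x y → SameBlock _≺_ y z → SameBlock _≺_ x z
  SameBlock-trans {x} {y} {z} (xs , xy∈xs) (ys , yz∈ys) = y ∷ xs ++ ys , between∈
    where
    between∈ : ∀ w → Between _≺_ x z w → w ∈ y ∷ xs ++ ys
    between∈ w x-w-z with total w y
    ... | inj₂ (inj₁ refl) = here refl
    between∈ w (inj₁ (x≺w , w≺z)) | inj₁ w≺y        = there (∈-++⁺ˡ (xy∈xs w (inj₁ (x≺w , w≺y))))
    between∈ w (inj₂ (z≺w , w≺x)) | inj₁ w≺y        = there (∈-++⁺ʳ xs (yz∈ys w (inj₂ (z≺w , w≺y))))
    between∈ w (inj₁ (x≺w , w≺z)) | inj₂ (inj₂ y≺w) = there (∈-++⁺ʳ xs (yz∈ys w (inj₁ (y≺w , w≺z))))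
    between∈ w (inj₂ (z≺w , w≺x)) | inj₂ (inj₂ y≺w) = there (∈-++⁺ˡ (xy∈xs w (inj₂ (y≺w , w≺x))))

  Covers⇒SameBlock : ∀ {x y} → Covers _≺_ x y → SameBlock _≺_ x y
  Covers⇒SameBlock (x≺y , nothing-between) = [] , between∈
    where
    between∈ : ∀ z → Between _≺_ _ _ z → z ∈ []
    between∈ z (inj₁ x-z-y)         = ⊥-elim (nothing-between z x-z-y)
    between∈ z (inj₂ (y≺z , z≺x))   = ⊥-elim (≺-asym x≺y (≺-trans y≺z z≺x))

module TITOProperties {n : ℕ} {{_ : NonZero n}} {_≺_ : ℤ → ℤ → Set} (T : TITO n _≺_) where

  open TITO T
  open Congruence n using (N; ≡[]⇒multiple)
  open StrictTotalProperties strictTotal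

  ≺-+N : ∀ {x y} → x ≺ y → (x + N) ≺ (y + N)
  ≺-+N {x} {y} = proj₁ (transl x y)

  ≺-+N⁻ : ∀ {x y} → (x + N) ≺ (y + N) → x ≺ y
  ≺-+N⁻ {x} {y} = proj₂ (transl x y)

  ≺-+ℕ* : ∀ j {x y} → x ≺ y → (x + + j * N) ≺ (y + + j * N)
  ≺-+ℕ* zero    {x} {y} = subst₂ _≺_ (sym (+-identityʳ x)) (sym (+-identityʳ y))
  ≺-+ℕ* (suc j) {x} {y} = subst₂ _≺_ (sym (shift-suc x j N)) (sym (shift-suc y j N)) ∘ ≺-+N ∘ ≺-+ℕ* j

  ≺-+ℕ*⁻ : ∀ j {x y} → (x + + j * N) ≺ (y + + j * N) → x ≺ y
  ≺-+ℕ*⁻ zero    {x} {y} = subst₂ _≺_ (+-identityʳ x) (+-identityʳ y)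
  ≺-+ℕ*⁻ (suc j) {x} {y} = ≺-+ℕ*⁻ j ∘ ≺-+N⁻ ∘ subst₂ _≺_ (shift-suc x j N) (shift-suc y j N)

  ≺-translate : ∀ k {x y} → x ≺ y → (x + k * N) ≺ (y + k * N)
  ≺-translate (+ j)    = ≺-+ℕ* j
  ≺-translate -[1+ j ] {x} {y} x≺y =
    ≺-+ℕ*⁻ (suc j) (subst₂ _≺_ (sym (shift-cancel x (+ suc j) N)) (sym (shift-cancel y (+ suc j) N)) x≺y)

  x<x+N : ∀ x → x < x + N
  x<x+N x = subst (_< x + N) (+-identityʳ x) (+-monoʳ-< x (ℤ.+<+ (ℕ.>-nonZero⁻¹ n)))

  x-N+N : ∀ x → (x - N) + N ≡ x
  x-N+N x = cancel x N
    where
    cancel : ∀ x N → (x - N) + N ≡ x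
    cancel = solve-∀

  x-N<x : ∀ x → x - N < x
  x-N<x x = subst (x - N <_) (x-N+N x) (x<x+N (x - N))

  Waning : ℤ → Set
  Waning x = (x + N) ≺ x

  waning-translate : ∀ k {x} → Waning x → Waning (x + k * N)
  waning-translate k {x} = subst (_≺ (x + k * N)) (commute x k N) ∘ ≺-translate k
    where
    commute : ∀ x k N → (x + N) + k * N ≡ (x + k * N) + N
    commute = solve-∀

  waning-−N : ∀ {x} → Waning x → Waning (x - N)
  waning-−N {x} x-waning = ≺-+N⁻ (subst₂ _≺_ (sym (cong (_+ N) (x-N+N x))) (sym (x-N+N x)) x-waning)

  waning-descends : ∀ {x} → Waning x → ∀ j → (x + + suc j * N) ≺ x
  waning-descends {x} x-waning zero    = subst (_≺ x) (cong (λ m → x + m) (sym (*-identityˡ N))) x-waning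
  waning-descends {x} x-waning (suc j) =
    ≺-trans (subst (_≺ (x + + suc j * N)) (sym (shift-suc x (suc j) N)) (waning-translate (+ suc j) x-waning))
            (waning-descends x-waning j)

  waning-ascends : ∀ {x} → Waning x → ∀ j → x ≺ (x + -[1+ j ] * N)
  waning-ascends {x} x-waning j =
    subst (_≺ (x + -[1+ j ] * N)) (shift-cancel x (+ suc j) N)
          (waning-descends (waning-translate -[1+ j ] x-waning) j)

  waning-between : ∀ {x z} → (x + N) ≺ z → z ≺ x → Waning z
  waning-between {x} {z} x+N≺z z≺x = ≢∧⊁⇒≺ z+N≢z z⊀z+N
    where
    z+N≺x+N : (z + N) ≺ (x + N)
    z+N≺x+N = ≺-+N z≺x
    z+N≢z : z + N ≢ z
    z+N≢z z+N≡z = ≺-asym x+N≺z (subst (_≺ (x + N)) z+N≡z z+N≺x+N)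
    z⊀z+N : ¬ (z ≺ (z + N))
    z⊀z+N z≺z+N = ≺-irrefl (≺-trans z≺z+N (≺-trans z+N≺x+N x+N≺z))

  unbounded-above : ∀ x y → ∃[ j ] (y < x + + suc j * N)
  unbounded-above x y = j , (begin-strict
    y                ≡⟨ rearrange x y ⟩
    x + (y - x)      ≤⟨ +-monoʳ-≤ x (i≤+∣i∣ (y - x)) ⟩
    x + + j          <⟨ +-monoʳ-< x (ℤ.+<+ (ℕ.n<1+n j)) ⟩
    x + + suc j      ≤⟨ +-monoʳ-≤ x (subst (+ suc j ℤ.≤_) (pos-* (suc j) n) (+≤+ (ℕ.m≤m*n (suc j) n))) ⟩
    x + + suc j * N  ∎)
    where
    open ≤-Reasoning
    j = ∣ y - x ∣
    rearrange : ∀ x y → y ≡ x + (y - x)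
    rearrange = solve-∀

  unbounded-below : ∀ x y → ∃[ j ] (x + -[1+ j ] * N < y)
  unbounded-below x y with unbounded-above (- x) (- y)
  ... | j , -y<-x+kN = j , subst₂ _<_ (negate x (+ suc j) N) (neg-involutive y) (neg-mono-< -y<-x+kN)
    where
    negate : ∀ x k N → - (- x + k * N) ≡ x + (- k) * N
    negate = solve-∀

  -- The translates x + kN with k ≥ 2 precede x + N, and those with k < 0 follow x.
  incongruent-within-period : ∀ {x y} → (x + N) ≼ y → y ≺ x → y ≢ x + N → ¬ (x ≡[ n ] y)
  incongruent-within-period {x} {y} x+N≼y y≺x y≢x+N x≡y with ≡[]⇒multiple x y x≡y
  ... | + 0 , y≡x+0N           = ≺-irrefl (subst (_≺ x) (trans y≡x+0N (+-identityʳ x)) y≺x)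
  ... | + 1 , y≡x+1N           = y≢x+N (trans y≡x+1N (cong (λ m → x + m) (*-identityˡ N)))
  ... | + suc (suc j) , y≡x+kN =
    ≼⇒⊁ x+N≼y (subst (_≺ (x + N)) (sym (trans y≡x+kN (regroup x (+ suc j) N))) (waning-descends (≺-+N x-waning) j))
    where
    x-waning : Waning x
    x-waning = ≼-≺-trans x+N≼y y≺x
    regroup : ∀ x k N → x + (+ 1 + k) * N ≡ (x + N) + k * N
    regroup = solve-∀
  ... | -[1+ j ] , y≡x-kN      =
    ≺-asym y≺x (subst (x ≺_) (sym y≡x-kN) (waning-ascends (≼-≺-trans x+N≼y y≺x) j))

  escapes-block : ∀ {x y} → Waning x → SameBlock _≺_ x y → ∃[ j ] ((x + + suc j * N) ≺ y)
  escapes-block {x} {y} x-waning (zs , between∈zs) = j , ≢∧⊁⇒≺ x′≢y y⊀x′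
    where
    open Extrema ≤-totalOrder using () renaming (max to maxℤ; ⊥≤max to ⊥≤maxℤ; xs≤max to xs≤maxℤ)
    bound = maxℤ y zs
    j = proj₁ (unbounded-above x bound)
    x′ = x + + suc j * N
    bound<x′ : bound < x′
    bound<x′ = proj₂ (unbounded-above x bound)
    x′≢y : x′ ≢ y
    x′≢y x′≡y = <⇒≱ bound<x′ (subst (ℤ._≤ bound) (sym x′≡y) (⊥≤maxℤ y zs))
    y⊀x′ : ¬ (y ≺ x′)
    y⊀x′ y≺x′ =
      <⇒≱ bound<x′ (All.lookup (xs≤maxℤ y zs) (between∈zs x′ (inj₂ (y≺x′ , waning-descends x-waning j))))

module SortableProperties {n : ℕ} {{_ : NonZero n}} {c : ℤ → ℤ} (cox : IsCoxeter n c)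
                   {_≺_ : ℤ → ℤ → Set} (T : TITO n _≺_) (S : Sortable n c _≺_) where

  open TITO T using (strictTotal; noCover)
  open Sortable S using (noL; noR)
  open Congruence n using (N)
  open AffineSymmetricGroup n using (coxeter-periodic; coxeter-moves)
  open StrictTotalProperties strictTotal
  open TITOProperties T

  InL-translate : ∀ k {x} → InL c x → InL c (x + k * N)
  InL-translate k {x} x<cx =
    subst (x + k * N <_) (sym (commutes-with-multiples c (coxeter-periodic cox) k x)) (+-monoˡ-< (k * N) x<cx)

  InR-translate : ∀ k {x} → InR c x → InR c (x + k * N)
  InR-translate k {x} cx<x =
    subst (_< x + k * N) (sym (commutes-with-multiples c (coxeter-periodic cox) k x)) (+-monoˡ-< (k * N) cx<x)

  -- Otherwise z < y < z + kN for large k, and z + kN ≺ z ≺ y is the pattern excluded by condition (2).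
  L-predecessors-larger : ∀ {y z} → InL c y → Waning z → z ≺ y → y < z
  L-predecessors-larger {y} {z} y∈L z-waning z≺y with <-cmp y z
  ... | tri< y<z _ _  = y<z
  ... | tri≈ _ refl _ = ⊥-elim (≺-irrefl z≺y)
  ... | tri> _ _ z<y with unbounded-above z y
  ...   | j , y<z′ = ⊥-elim (noL z y _ z<y y<z′ (waning-descends z-waning j , z≺y , y∈L))

  R-successors-smaller : ∀ {y z} → InR c y → Waning z → y ≺ z → z < y
  R-successors-smaller {y} {z} y∈R z-waning y≺z with <-cmp y z
  ... | tri> _ _ z<y  = z<y
  ... | tri≈ _ refl _ = ⊥-elim (≺-irrefl y≺z)
  ... | tri< y<z _ _ with unbounded-below z y
  ...   | j , z′<y = ⊥-elim (noR _ y z z′<y y<z (y≺z , waning-ascends z-waning j , y∈R))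

  L-precedes-smaller : ∀ {y z} → InL c y → Waning z → z < y → y ≺ z
  L-precedes-smaller y∈L z-waning z<y =
    ≢∧⊁⇒≺ (<⇒≢ z<y ∘ sym) (<-asym z<y ∘ L-predecessors-larger y∈L z-waning)

  R-follows-larger : ∀ {y z} → InR c y → Waning z → y < z → z ≺ y
  R-follows-larger y∈R z-waning y<z =
    ≢∧⊁⇒≺ (<⇒≢ y<z ∘ sym) (<-asym y<z ∘ R-successors-smaller y∈R z-waning)

  L-cover : ∀ {a r} → InL c a → Waning a → InR c r → Waning r → r ≺ (a + N) → ∃[ q ] InCov n _≺_ a q
  L-cover {a} {r} a∈L a-waning r∈R r-waning r≺a+N =
    cover (immediate-predecessor (integers-between a hi) a-waning between∈)
    where
    hi = (a + N) ⊔ r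
    bounds : ∀ z → (a + N) ≺ z → z ≺ a → a < z × z ℤ.≤ hi
    bounds z a+N≺z z≺a = L-predecessors-larger a∈L z-waning z≺a , below-hi (coxeter-moves cox z)
      where
      z-waning = waning-between a+N≺z z≺a
      below-hi : InL c z ⊎ InR c z → z ℤ.≤ hi
      below-hi (inj₁ z∈L) = ≤-trans (<⇒≤ (L-predecessors-larger z∈L (≺-+N a-waning) a+N≺z)) (i≤i⊔j _ _)
      below-hi (inj₂ z∈R) =
        ≤-trans (<⇒≤ (R-successors-smaller r∈R z-waning (≺-trans r≺a+N a+N≺z))) (i≤j⊔i _ _)
    between∈ : ∀ z → (a + N) ≺ z → z ≺ a → z ∈ integers-between a hi
    between∈ z a+N≺z z≺a with bounds z a+N≺z z≺a
    ... | a<z , z≤hi = ∈-integers-between (<⇒≤ a<z) z≤hi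
    cover : ∃[ q ] ((a + N) ≼ q × Covers _≺_ q a) → ∃[ q ] InCov n _≺_ a q
    cover (q , a+N≼q , q-covers-a@(q≺a , _)) =
      q , a<q a+N≼q , incongruent-within-period a+N≼q q≺a q≢a+N , q-covers-a
      where
      a<q : (a + N) ≼ q → a < q
      a<q (inj₁ a+N≺q) = proj₁ (bounds q a+N≺q q≺a)
      a<q (inj₂ refl)  = x<x+N a
      q≢a+N : q ≢ a + N
      q≢a+N refl = noCover a q-covers-a

  R-cover : ∀ {a l} → InR c a → Waning a → InL c l → Waning l → (a - N) ≺ l → ∃[ s ] InCov n _≺_ s a
  R-cover {a} {l} a∈R a-waning l∈L l-waning a-N≺l =
    cover (immediate-successor (integers-between lo a) a≺a-N between∈)
    where
    lo = (a - N) ⊓ l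
    a≺a-N : a ≺ (a - N)
    a≺a-N = subst (_≺ (a - N)) (x-N+N a) (waning-−N a-waning)
    bounds : ∀ z → a ≺ z → z ≺ (a - N) → lo ℤ.≤ z × z < a
    bounds z a≺z z≺a-N = above-lo (coxeter-moves cox z) , R-successors-smaller a∈R z-waning a≺z
      where
      z-waning = waning-between (subst (_≺ z) (sym (x-N+N a)) a≺z) z≺a-N
      above-lo : InL c z ⊎ InR c z → lo ℤ.≤ z
      above-lo (inj₁ z∈L) =
        ≤-trans (i⊓j≤j _ _) (<⇒≤ (L-predecessors-larger l∈L z-waning (≺-trans z≺a-N a-N≺l)))
      above-lo (inj₂ z∈R) = ≤-trans (i⊓j≤i _ _) (<⇒≤ (R-successors-smaller z∈R (waning-−N a-waning) z≺a-N))
    between∈ : ∀ z → a ≺ z → z ≺ (a - N) → z ∈ integers-between lo a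
    between∈ z a≺z z≺a-N with bounds z a≺z z≺a-N
    ... | lo≤z , z<a = ∈-integers-between lo≤z (<⇒≤ z<a)
    cover : ∃[ s ] (s ≼ (a - N) × Covers _≺_ a s) → ∃[ s ] InCov n _≺_ s a
    cover (s , s≼a-N , a-covers-s@(a≺s , _)) =
      s , s<a s≼a-N , incongruent-within-period (s+N≼a s≼a-N) a≺s a≢s+N , a-covers-s
      where
      s<a : s ≼ (a - N) → s < a
      s<a (inj₁ s≺a-N) = proj₂ (bounds s a≺s s≺a-N)
      s<a (inj₂ refl)  = x-N<x a
      s+N≼a : s ≼ (a - N) → (s + N) ≼ a
      s+N≼a (inj₁ s≺a-N) = inj₁ (subst ((s + N) ≺_) (x-N+N a) (≺-+N s≺a-N))
      s+N≼a (inj₂ refl)  = inj₂ (x-N+N a)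
      a≢s+N : a ≢ s + N
      a≢s+N a≡s+N = noCover s (subst (λ v → Covers _≺_ v s) a≡s+N a-covers-s)

  record WaningRBeforeL : Set where
    field
      {r l}    : ℤ
      r∈R      : InR c r
      l∈L      : InL c l
      r-waning : Waning r
      l-waning : Waning l
      r≺l      : r ≺ l

  -- The only use of condition (1): the waning block meets R̄ and L̄, and being a block it cannot
  -- contain all the translates of its element r ∈ R̄ that precede r.
  waning-R-before-L : ThreeBlocks n c _≺_ → WaningRBeforeL
  waning-R-before-L (m′ , block-waning , (l , l~m′ , l∈L) , (r , r~m′ , r∈R) , _)
    with escapes-block (block-waning r r~m′) (SameBlock-trans r~m′ (SameBlock-sym l~m′))
  ... | j , r′≺l = record
    { r∈R      = InR-translate (+ suc j) r∈R
    ; l∈L      = l∈L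
    ; r-waning = waning-translate (+ suc j) (block-waning r r~m′)
    ; l-waning = block-waning l l~m′
    ; r≺l      = r′≺l
    }

  module _ (W : WaningRBeforeL) where

    open WaningRBeforeL W

    R-before : ∀ {t} → Waning t → ∃[ r′ ] (InR c r′ × Waning r′ × r′ ≺ t)
    R-before {t} t-waning with unbounded-above l t
    ... | j , t<l′ = r + k * N , InR-translate k r∈R , waning-translate k r-waning ,
                     ≺-trans (≺-translate k r≺l) (L-precedes-smaller (InL-translate k l∈L) t-waning t<l′)
      where k = + suc j

    L-after : ∀ {t} → Waning t → ∃[ l′ ] (InL c l′ × Waning l′ × t ≺ l′)
    L-after {t} t-waning with unbounded-below r t
    ... | j , r′<t = l + k * N , InL-translate k l∈L , waning-translate k l-waning ,
                     ≺-trans (R-follows-larger (InR-translate k r∈R) t-waning r′<t) (≺-translate k r≺l)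
      where k = -[1+ j ]

    cover-through : ∀ {a} → Waning a → ∃[ b ] (InCov n _≺_ a b ⊎ InCov n _≺_ b a)
    cover-through {a} a-waning with coxeter-moves cox a
    ... | inj₁ a∈L with R-before (≺-+N a-waning)
    ...   | _ , r′∈R , r′-waning , r′≺a+N = map₂ inj₁ (L-cover a∈L a-waning r′∈R r′-waning r′≺a+N)
    cover-through {a} a-waning | inj₂ a∈R with L-after (waning-−N a-waning)
    ...   | _ , l′∈L , l′-waning , a-N≺l′ = map₂ inj₂ (R-cover a∈R a-waning l′∈L l′-waning a-N≺l′)

lemma3p5 : (n : ℕ) → 2 ≤ n → (c : ℤ → ℤ) → IsCoxeter n c →
    (_≺_ : ℤ → ℤ → Set) → TITO n _≺_ → Sortable n c _≺_ → ¬ SingleWaxing n _≺_ →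
    (m : ℤ) → WaningBlock n _≺_ m →
    ∀ a → SameBlock _≺_ a m →
    ∃[ p ] ∃[ q ] (InCov n _≺_ p q
    × ∃[ b ] (SameBlock _≺_ b m × ¬ (a ≡[ n ] b) × (∀ x → transp n p q x ≡ transp n a b x)))
lemma3p5 n 2≤n c cox _≺_ T S not-single m m-waning a a~m =
  as-reflection (cover-through (waning-R-before-L three-blocks) (m-waning a a~m))
  where
  -- The argument only needs n ≠ 0.
  instance
    n-nonZero : NonZero n
    n-nonZero = ℕ.>-nonZero (ℕ.<-≤-trans (s≤s z≤n) 2≤n)
  open StrictTotalProperties (TITO.strictTotal T) using (SameBlock-sym; SameBlock-trans; Covers⇒SameBlock)
  open Congruence n using (≡[]-sym)
  open AffineSymmetricGroup n using (transp-sym)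
  open SortableProperties cox T S using (waning-R-before-L; cover-through)

  three-blocks : ThreeBlocks n c _≺_
  three-blocks = [ ⊥-elim ∘ not-single , id ]′ (Sortable.blocks S)

  as-reflection : ∃[ b ] (InCov n _≺_ a b ⊎ InCov n _≺_ b a) →
    ∃[ p ] ∃[ q ] (InCov n _≺_ p q
    × ∃[ b ] (SameBlock _≺_ b m × ¬ (a ≡[ n ] b) × (∀ x → transp n p q x ≡ transp n a b x)))
  as-reflection (b , inj₁ a-b@(_ , a≢b , b-covers-a)) =
    a , b , a-b , b , SameBlock-trans (Covers⇒SameBlock b-covers-a) a~m , a≢b , λ _ → refl
  as-reflection (b , inj₂ b-a@(_ , b≢a , a-covers-b)) =
    b , a , b-a , b , SameBlock-trans (SameBlock-sym (Covers⇒SameBlock a-covers-b)) a~m ,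
    b≢a ∘ ≡[]-sym a b , transp-sym b≢a
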